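{- Let $r,t$ be positive integers with $r\neq t$. Then the complete bipartite graph $K_{r,t}$ is of class $1^\pm$.
   Context: A signed graph is a pair $(G,\sigma)$ with $G$ a finite simple graph and $\sigma\colon E(G)\to\{\pm1\}$ a signature. An incidence is a pair $v\colon e$ with $v$ an endpoint of edge $e$; $I(G)$ is the set of incidences. For a positive integer $n$ let $M_n=\{0,\pm1,\dots,\pm k\}$ if $n=2k+1$ and $M_n=\{\pm1,\dots,\pm k\}$ if $n=2k$. An $n$-edge-coloring of $(G,\sigma)$ is a map $f\colon I(G)\to M_n$ with $f(u\colon uv)=-\sigma(uv)f(v\colon uv)$ for every edge $uv$, and $f(u\colon e_1)\neq f(u\colon e_2)$ whenever $e_1\neq e_2$ are both incident to $u$. The chromatic index $\chi'(G,\sigma)$ is the least positive integer $n$ for which an $n$-edge-coloring exists. A graph $G$ is of class $1^\pm$ if $\chi'(G,\sigma)=\Delta(G)$ for every signature $\sigma$ of $G$, where $\Delta(G)$ is the maximum degree. -}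

module Defs where

open import Data.Nat as ℕ using (ℕ; zero; suc; _⊔_; _<ᵇ_)
open import Data.Integer as ℤ using (ℤ; ∣_∣)
open import Data.Bool using (Bool; true; false; _xor_; if_then_else_)
open import Data.Bool.Properties using (xor-same)
open import Data.Fin using (Fin; toℕ)
open import Data.List using (List; map; foldr; allFin)
open import Data.Nat.ListAction using (sum)
open import Data.Sign using (Sign)
open import Data.Product using (Σ; ∃; _×_; _,_)
open import Data.Sum using (_⊎_)
open import Relation.Nullary using (¬_)
open import Relation.Binary.PropositionalEquality using (_≡_; _≢_; refl)

record Graph : Set where
  field
    n     : ℕ
    adj   : Fin n → Fin n → Bool
    sym   : ∀ u v → adj u v ≡ adj v u
    irrefl : ∀ u → adj u u ≡ false
open Graph public

Adj : (G : Graph) → Fin (n G) → Fin (n G) → Set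
Adj G u v = adj G u v ≡ true

degree : (G : Graph) → Fin (n G) → ℕ
degree G u = sum (map (λ v → if adj G u v then 1 else 0) (allFin (n G)))

Δ : Graph → ℕ
Δ G = foldr _⊔_ 0 (map (degree G) (allFin (n G)))

-- Signatures: σ(uv) ∈ {±1} for each edge uv, i.e. a sign assigned to each
-- adjacent pair, symmetric in the pair (values on non-edges are irrelevant).

record Signature (G : Graph) : Set where
  field
    σ   : Fin (n G) → Fin (n G) → Sign
    σ-sym : ∀ u v → Adj G u v → σ u v ≡ σ v u
open Signature public

sgn : Sign → ℤ
sgn Sign.+ = ℤ.+ 1
sgn Sign.- = ℤ.- (ℤ.+ 1)

-- The colour set M_m:
--   m = 2k+1 : {0, ±1, …, ±k}
--   m = 2k   : {±1, …, ±k}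

InM : ℕ → ℤ → Set
InM m c =
  (∃ λ k → (m ≡ suc (2 ℕ.* k)) × (∣ c ∣ ℕ.≤ k)) ⊎
  (∃ λ k → (m ≡ 2 ℕ.* k) × (1 ℕ.≤ ∣ c ∣) × (∣ c ∣ ℕ.≤ k))

-- m-edge-colourings of a signed graph.
-- An incidence u:uv is represented by the ordered adjacent pair (u , v);
-- f u v is the colour f(u : uv).

record EdgeColoring (G : Graph) (s : Signature G) (m : ℕ) : Set where
  field
    f      : Fin (n G) → Fin (n G) → ℤ
    inM    : ∀ u v → Adj G u v → InM m (f u v)
    signed : ∀ u v → Adj G u v → f u v ≡ ℤ.- (sgn (σ s u v) ℤ.* f v u)
    proper : ∀ u v w → Adj G u v → Adj G u w → v ≢ w → f u v ≢ f u w

Colorable : (G : Graph) → Signature G → ℕ → Set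
Colorable G s m = EdgeColoring G s m

ChromaticIndexIs : (G : Graph) → Signature G → ℕ → Set
ChromaticIndexIs G s m =
  (1 ℕ.≤ m) × Colorable G s m × (∀ k → 1 ℕ.≤ k → k ℕ.< m → ¬ Colorable G s k)

Class1± : Graph → Set
Class1± G = ∀ (s : Signature G) → ChromaticIndexIs G s (Δ G)

-- Complete bipartite graph K_{r,t}: vertices Fin (r + t), the first r
-- forming one side and the remaining t the other.

private
  xor-comm : ∀ a b → a xor b ≡ b xor a
  xor-comm false false = refl
  xor-comm false true  = refl
  xor-comm true  false = refl
  xor-comm true  true  = refl

K : ℕ → ℕ → Graph
K r t = record
  { n      = r ℕ.+ t
  ; adj    = λ u v → (toℕ u <ᵇ r) xor (toℕ v <ᵇ r)
  ; sym    = λ u v → xor-comm (toℕ u <ᵇ r) (toℕ v <ᵇ r)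
  ; irrefl = λ u → xor-same (toℕ u <ᵇ r)
  }

module Submission where

-- Since K r t ≅ K t r, assume r < t; then Δ = t, and a vertex of degree t needs t distinct colours
-- from M_m, which has m elements, so χ' ≥ t.  For the colouring, number the left vertices
-- x < r and the right ones y < t and give the edge xy the symbol e = y − x (mod t) of the cyclic
-- Latin square, so that the symbols at every vertex are distinct.  The symbols 2i and 2i+1 become
-- the colours ±(i+1) with opposite signs, up to a sign depending on the row x and the pair i (for
-- odd t the symbol t−1 becomes 0), so rows see distinct colours.  At a right vertex y, after
-- multiplying by σ, two incidences can only clash on a pair {2i+1, 2i} coming from rows x and x+1;
-- choosing the signs row by row along x = 0, 1, … removes every such clash, and this recursion
-- closes up without conflict precisely because the r < t rows form a path, not a cycle.

open import Data.Nat as ℕ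
  using (ℕ; zero; suc; pred; _+_; _∸_; _≤_; _<_; _⊔_; _<ᵇ_; _≟_; _≤?_; z≤n; s≤s; ⌊_/2⌋; parity)
open import Data.Nat.Properties as ℕ
  using (+-suc; *-cancelˡ-≡; *-monoʳ-≤; *-monoʳ-<; ≤∧≢⇒<; ⌊n/2⌋-mono)
open import Data.Nat.DivMod using (_mod_; m<n⇒m%n≡m)
open import Data.Nat.ListAction using (sum)
open import Data.Integer as ℤ using (ℤ; +_; -[1+_]; ∣_∣; _◃_; 1ℤ; -1ℤ)
import Data.Integer.Properties as ℤ
open import Data.Parity.Base as Parity using (0ℙ; 1ℙ; toSign)
import Data.Parity.Properties as ℙ
open import Data.Sign as Sign using (Sign; _*_)
import Data.Sign.Properties as Sign
open import Data.Fin as Fin using (Fin; toℕ; fromℕ<; _↑ˡ_; _↑ʳ_; splitAt)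
import Data.Fin.Properties as Fin
open import Data.Bool using (Bool; true; false; not; _xor_; if_then_else_)
open import Data.Bool.Properties using (xor-annihilates-not)
open import Data.Empty using (⊥-elim)
open import Data.Product using (_×_; _,_; proj₁; proj₂)
open import Data.Sum using (_⊎_; inj₁; inj₂; [_,_]′)
open import Data.List using (foldr; tabulate)
open import Data.List.Properties using (foldr-preservesᵇ; map-tabulate)
open import Data.List.Membership.Propositional using (_∈_)
open import Data.List.Membership.Propositional.Properties using (∈-map⁺; ∈-allFin)
open import Data.List.Relation.Unary.Any using (here; there)
open import Data.List.Relation.Unary.All using (All)
import Data.List.Relation.Unary.All.Properties as All
open import Function using (_∘_; id)
open import Function.Definitions using (Injective)
open import Relation.Nullary using (¬_; yes; no)
open import Relation.Nullary.Decidable using (decidable-stable)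
open import Relation.Binary.Definitions using (tri<; tri≈; tri>)
open import Relation.Binary.PropositionalEquality
open ≡-Reasoning
open import Defs hiding (sym)

parity-even : ∀ n → parity (2 ℕ.* n) ≡ 0ℙ
parity-even n = ℙ.*-homo-* 2 n

parity-odd : ∀ n → parity (suc (2 ℕ.* n)) ≡ 1ℙ
parity-odd n = trans (ℙ.+-homo-+ 1 (2 ℕ.* n)) (cong Parity._⁻¹ (parity-even n))

even⇒≡2*⌊/2⌋ : ∀ {n} → parity n ≡ 0ℙ → n ≡ 2 ℕ.* ⌊ n /2⌋
even⇒≡2*⌊/2⌋ {zero} _ = refl
even⇒≡2*⌊/2⌋ {suc (suc n)} p =
  trans (cong (suc ∘ suc) (even⇒≡2*⌊/2⌋ p)) (sym (ℕ.*-suc 2 ⌊ n /2⌋))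

odd⇒≡1+2*⌊/2⌋ : ∀ {n} → parity n ≡ 1ℙ → n ≡ suc (2 ℕ.* ⌊ n /2⌋)
odd⇒≡1+2*⌊/2⌋ {suc zero} _ = refl
odd⇒≡1+2*⌊/2⌋ {suc (suc n)} p =
  trans (cong (suc ∘ suc) (odd⇒≡1+2*⌊/2⌋ p)) (cong suc (sym (ℕ.*-suc 2 ⌊ n /2⌋)))

⌊/2⌋-parity-injective : ∀ {m n} → ⌊ m /2⌋ ≡ ⌊ n /2⌋ → parity m ≡ parity n → m ≡ n
⌊/2⌋-parity-injective {m} {n} h p with parity m in pm
... | 0ℙ = trans (even⇒≡2*⌊/2⌋ pm) (trans (cong (2 ℕ.*_) h) (sym (even⇒≡2*⌊/2⌋ (sym p))))
... | 1ℙ = trans (odd⇒≡1+2*⌊/2⌋ pm) (trans (cong (suc ∘ (2 ℕ.*_)) h) (sym (odd⇒≡1+2*⌊/2⌋ (sym p))))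

⌊/2⌋-odd≡suc-even : ∀ {m n} → ⌊ m /2⌋ ≡ ⌊ n /2⌋ → parity m ≡ 1ℙ → parity n ≡ 0ℙ → m ≡ suc n
⌊/2⌋-odd≡suc-even h pm pn =
  trans (odd⇒≡1+2*⌊/2⌋ pm) (cong suc (trans (cong (2 ℕ.*_) h) (sym (even⇒≡2*⌊/2⌋ pn))))

⌊/2⌋-top : ∀ {m n} → m < n → ⌊ m /2⌋ ≡ ⌊ n /2⌋ → suc m ≡ n × parity n ≡ 1ℙ
⌊/2⌋-top {zero} {suc zero} _ _ = refl , refl
⌊/2⌋-top {suc (suc m)} {suc (suc n)} (s≤s (s≤s m<n)) h with ⌊/2⌋-top m<n (ℕ.suc-injective h)
... | refl , p = refl , p

InM-◃ : ∀ {m n} s → n < ⌊ m /2⌋ → InM m (s ◃ suc n)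
InM-◃ {m} {n} s n<k with parity m in pm
... | 0ℙ = inj₂ (⌊ m /2⌋ , even⇒≡2*⌊/2⌋ pm , subst (1 ≤_) ∣c∣ (s≤s z≤n) , subst (_≤ ⌊ m /2⌋) ∣c∣ n<k)
  where
  ∣c∣ : suc n ≡ ∣ s ◃ suc n ∣
  ∣c∣ = sym (ℤ.abs-◃ s (suc n))
... | 1ℙ = inj₁ (⌊ m /2⌋ , odd⇒≡1+2*⌊/2⌋ pm , subst (_≤ ⌊ m /2⌋) (sym (ℤ.abs-◃ s (suc n))) n<k)

InM-0 : ∀ {m} → parity m ≡ 1ℙ → InM m (+ 0)
InM-0 {m} pm = inj₁ (⌊ m /2⌋ , odd⇒≡1+2*⌊/2⌋ pm , z≤n)

zigzag : ℤ → ℕ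
zigzag (+ n)    = 2 ℕ.* n
zigzag -[1+ n ] = suc (2 ℕ.* n)

zigzag-injective : Injective _≡_ _≡_ zigzag
zigzag-injective {+ m}      {+ n}      eq = cong +_ (*-cancelˡ-≡ m n 2 eq)
zigzag-injective { -[1+ m ]} { -[1+ n ]} eq = cong -[1+_] (*-cancelˡ-≡ m n 2 (ℕ.suc-injective eq))
zigzag-injective {+ m}      { -[1+ n ]} eq
  with () ← trans (sym (parity-even m)) (trans (cong parity eq) (parity-odd n))
zigzag-injective { -[1+ m ]} {+ n}      eq
  with () ← trans (sym (parity-odd m)) (trans (cong parity eq) (parity-even n))

-- zigzag lists ℤ as 0, −1, 1, −2, 2, …; for even m, 0 ∉ M_m and the indices shift down by one.
M-index : ∀ m c → InM m c → ℕ
M-index _ c (inj₁ _) = zigzag c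
M-index _ c (inj₂ _) = pred (zigzag c)

M-index-< : ∀ m c (p : InM m c) → M-index m c p < m
M-index-< _ (+ n)      (inj₁ (j , refl , n≤j))     = s≤s (*-monoʳ-≤ 2 n≤j)
M-index-< _ -[1+ n ]   (inj₁ (j , refl , n<j))     = s≤s (*-monoʳ-< 2 n<j)
M-index-< _ (+ suc n)  (inj₂ (j , refl , _ , n<j)) = *-monoʳ-≤ 2 n<j
M-index-< _ -[1+ n ]   (inj₂ (j , refl , _ , n<j)) = *-monoʳ-< 2 n<j

M-index-injective : ∀ m c c' (p : InM m c) (q : InM m c') → M-index m c p ≡ M-index m c' q → c ≡ c'
M-index-injective _ _ _ (inj₁ _) (inj₁ _) eq = zigzag-injective eq
M-index-injective _ c c' (inj₂ (_ , _ , 1≤∣c∣ , _)) (inj₂ (_ , _ , 1≤∣c'∣ , _)) eq =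
  zigzag-injective (trans (sym (suc-pred-zigzag c 1≤∣c∣))
                          (trans (cong suc eq) (suc-pred-zigzag c' 1≤∣c'∣)))
  where
  suc-pred-zigzag : ∀ c → 1 ≤ ∣ c ∣ → suc (pred (zigzag c)) ≡ zigzag c
  suc-pred-zigzag (+ suc n) _ = refl
  suc-pred-zigzag -[1+ n ]  _ = refl
M-index-injective _ _ _ (inj₁ (j , m≡odd , _)) (inj₂ (j' , m≡even , _)) _
  with () ← trans (sym (parity-odd j)) (trans (cong parity (trans (sym m≡odd) m≡even)) (parity-even j'))
M-index-injective _ _ _ (inj₂ (j , m≡even , _)) (inj₁ (j' , m≡odd , _)) _
  with () ← trans (sym (parity-odd j')) (trans (cong parity (trans (sym m≡odd) m≡even)) (parity-even j))

M-injection⇒≤ : ∀ {d} m (g : Fin d → ℤ) → (∀ i → InM m (g i)) → Injective _≡_ _≡_ g → d ≤ m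
M-injection⇒≤ {d} m g g∈M g-injective = Fin.injective⇒≤ {f = index} λ {i} {j} eq →
  g-injective (M-index-injective m (g i) (g j) (g∈M i) (g∈M j)
    (trans (sym (Fin.toℕ-fromℕ< _)) (trans (cong toℕ eq) (Fin.toℕ-fromℕ< _))))
  where
  index : Fin d → Fin m
  index i = fromℕ< (M-index-< m (g i) (g∈M i))

∣-sgn*∣ : ∀ s c → ∣ ℤ.- (sgn s ℤ.* c) ∣ ≡ ∣ c ∣
∣-sgn*∣ s c = trans (ℤ.∣-i∣≡∣i∣ (sgn s ℤ.* c)) (trans (ℤ.abs-* (sgn s) c) (∣sgn∣*n s))
  where
  ∣sgn∣*n : ∀ s → ∣ sgn s ∣ ℕ.* ∣ c ∣ ≡ ∣ c ∣
  ∣sgn∣*n Sign.+ = ℕ.*-identityˡ ∣ c ∣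
  ∣sgn∣*n Sign.- = ℕ.*-identityˡ ∣ c ∣

InM-neg-sgn* : ∀ {m} s c → InM m c → InM m (ℤ.- (sgn s ℤ.* c))
InM-neg-sgn* s c (inj₁ (k , m≡ , ∣c∣≤k))        =
  inj₁ (k , m≡ , subst (_≤ k) (sym (∣-sgn*∣ s c)) ∣c∣≤k)
InM-neg-sgn* s c (inj₂ (k , m≡ , 1≤∣c∣ , ∣c∣≤k)) =
  inj₂ (k , m≡ , subst (1 ≤_) (sym (∣-sgn*∣ s c)) 1≤∣c∣ , subst (_≤ k) (sym (∣-sgn*∣ s c)) ∣c∣≤k)

-sgn*-involutive : ∀ s c → ℤ.- (sgn s ℤ.* ℤ.- (sgn s ℤ.* c)) ≡ c
-sgn*-involutive Sign.+ c = begin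
  ℤ.- (1ℤ ℤ.* ℤ.- (1ℤ ℤ.* c)) ≡⟨ cong ℤ.-_ (ℤ.*-identityˡ _) ⟩
  ℤ.- ℤ.- (1ℤ ℤ.* c)          ≡⟨ ℤ.neg-involutive _ ⟩
  1ℤ ℤ.* c                    ≡⟨ ℤ.*-identityˡ c ⟩
  c                           ∎
-sgn*-involutive Sign.- c = begin
  ℤ.- (-1ℤ ℤ.* ℤ.- (-1ℤ ℤ.* c)) ≡⟨ cong ℤ.-_ (ℤ.-1*i≡-i _) ⟩
  ℤ.- ℤ.- ℤ.- (-1ℤ ℤ.* c)       ≡⟨ ℤ.neg-involutive _ ⟩
  ℤ.- (-1ℤ ℤ.* c)               ≡⟨ cong ℤ.-_ (ℤ.-1*i≡-i c) ⟩
  ℤ.- ℤ.- c                     ≡⟨ ℤ.neg-involutive c ⟩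
  c                             ∎

-- Colouring the symbols of a Latin square

-- The symbols 2i and 2i+1 get the colours a(i+1) and −a(i+1); for odd m the last symbol m−1,
-- the only e < m with ⌊ e /2⌋ ≡ ⌊ m /2⌋, gets the colour 0.
colour : ℕ → Sign → ℕ → ℤ
colour m a e with ⌊ e /2⌋ ≟ ⌊ m /2⌋
... | yes _ = + 0
... | no  _ = (a * toSign (parity e)) ◃ suc ⌊ e /2⌋

colour-inM : ∀ {m e} a → e < m → InM m (colour m a e)
colour-inM {m} {e} a e<m with ⌊ e /2⌋ ≟ ⌊ m /2⌋
... | yes top = InM-0 (proj₂ (⌊/2⌋-top e<m top))
... | no ¬top = InM-◃ (a * toSign (parity e)) (≤∧≢⇒< (⌊n/2⌋-mono (ℕ.<⇒≤ e<m)) ¬top)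

sgn-*-colour : ∀ m s a e → sgn s ℤ.* colour m a e ≡ colour m (s * a) e
sgn-*-colour m s a e with ⌊ e /2⌋ ≟ ⌊ m /2⌋
... | yes _ = ℤ.*-zeroʳ (sgn s)
... | no  _ = begin
  sgn s ℤ.* ((a * p) ◃ suc h)        ≡⟨ cong (ℤ._* ((a * p) ◃ suc h)) (sgn≡◃1 s) ⟩
  (s ◃ 1) ℤ.* ((a * p) ◃ suc h)      ≡⟨ ℤ.◃-distrib-* s (a * p) 1 (suc h) ⟨
  (s * (a * p)) ◃ (1 ℕ.* suc h) ≡⟨ cong₂ _◃_ (sym (Sign.*-assoc s a p)) (ℕ.*-identityˡ (suc h)) ⟩
  ((s * a) * p) ◃ suc h         ∎
  where
  p : Sign
  p = toSign (parity e)
  h : ℕ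
  h = ⌊ e /2⌋
  sgn≡◃1 : ∀ s → sgn s ≡ s ◃ 1
  sgn≡◃1 Sign.+ = refl
  sgn≡◃1 Sign.- = refl

colour-clash : ∀ {m e e'} a b → e < m → e' < m → colour m a e ≡ colour m b e' →
  e ≡ e' ⊎ (⌊ e /2⌋ ≡ ⌊ e' /2⌋ × a * toSign (parity e) ≡ b * toSign (parity e'))
colour-clash {m} {e} {e'} a b e<m e'<m eq with ⌊ e /2⌋ ≟ ⌊ m /2⌋ | ⌊ e' /2⌋ ≟ ⌊ m /2⌋
... | yes top | yes top' =
  inj₁ (ℕ.suc-injective (trans (proj₁ (⌊/2⌋-top e<m top)) (sym (proj₁ (⌊/2⌋-top e'<m top')))))
... | yes _   | no _     with () ← trans (cong ∣_∣ eq) (ℤ.abs-◃ (b * toSign (parity e')) (suc ⌊ e' /2⌋))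
... | no _    | yes _    with () ← trans (sym (cong ∣_∣ eq)) (ℤ.abs-◃ (a * toSign (parity e)) (suc ⌊ e /2⌋))
... | no _    | no _     = inj₂ (ℕ.suc-injective (ℤ.abs-cong eq) , ℤ.sign-cong eq)

colour-injective : ∀ {m e e'} (a : ℕ → Sign) → e < m → e' < m →
  colour m (a ⌊ e /2⌋) e ≡ colour m (a ⌊ e' /2⌋) e' → e ≡ e'
colour-injective {e = e} {e'} a e<m e'<m eq with colour-clash (a ⌊ e /2⌋) (a ⌊ e' /2⌋) e<m e'<m eq
... | inj₁ e≡e'            = e≡e'
... | inj₂ (half≡ , signs) = ⌊/2⌋-parity-injective half≡ (ℙ.toSign-injective (Sign.*-cancelˡ-≡ (a ⌊ e' /2⌋) _ _
        (trans (cong (λ h → a h * toSign (parity e)) (sym half≡)) signs)))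

⊔-fold-upper : ∀ {x xs} → x ∈ xs → x ≤ foldr _⊔_ 0 xs
⊔-fold-upper (here refl) = ℕ.m≤m⊔n _ _
⊔-fold-upper (there x∈xs) = ℕ.≤-trans (⊔-fold-upper x∈xs) (ℕ.m≤n⊔m _ _)

⊔-fold-least : ∀ {m xs} → All (_≤ m) xs → foldr _⊔_ 0 xs ≤ m
⊔-fold-least = foldr-preservesᵇ ℕ.⊔-lub z≤n

degree≤Δ : ∀ G u → degree G u ≤ Δ G
degree≤Δ G u = ⊔-fold-upper (∈-map⁺ (degree G) (∈-allFin u))

Δ-least : ∀ G {m} → (∀ u → degree G u ≤ m) → Δ G ≤ m
Δ-least G bound = ⊔-fold-least (All.map⁺ (All.tabulate⁺ bound))

neighbours≤colours : ∀ {G s m d u} → EdgeColoring G s m →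
  (nb : Fin d → Fin (n G)) → Injective _≡_ _≡_ nb → (∀ i → Adj G u (nb i)) → d ≤ m
neighbours≤colours {m = m} {u = u} c nb nb-injective u~nb =
  M-injection⇒≤ m (λ i → f u (nb i)) (λ i → inM u (nb i) (u~nb i)) λ {i} {j} eq →
    nb-injective (decidable-stable (nb i Fin.≟ nb j)
      λ nbi≢nbj → proper u (nb i) (nb j) (u~nb i) (u~nb j) nbi≢nbj eq)
  where open EdgeColoring c

record Embedding (G H : Graph) : Set where
  field
    ⟦_⟧           : Fin (n G) → Fin (n H)
    injective     : Injective _≡_ _≡_ ⟦_⟧
    preserves-adj : ∀ {u v} → Adj G u v → Adj H ⟦ u ⟧ ⟦ v ⟧

module _ {G H : Graph} (φ : Embedding G H) where
  open Embedding φ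

  pullback : Signature H → Signature G
  pullback s = record
    { σ     = λ u v → σ s ⟦ u ⟧ ⟦ v ⟧
    ; σ-sym = λ u v u~v → σ-sym s ⟦ u ⟧ ⟦ v ⟧ (preserves-adj u~v)
    }

  restrict : ∀ {s m} → EdgeColoring H s m → EdgeColoring G (pullback s) m
  restrict c = record
    { f      = λ u v → f ⟦ u ⟧ ⟦ v ⟧
    ; inM    = λ u v u~v → inM ⟦ u ⟧ ⟦ v ⟧ (preserves-adj u~v)
    ; signed = λ u v u~v → signed ⟦ u ⟧ ⟦ v ⟧ (preserves-adj u~v)
    ; proper = λ u v w u~v u~w v≢w →
        proper ⟦ u ⟧ ⟦ v ⟧ ⟦ w ⟧ (preserves-adj u~v) (preserves-adj u~w) (v≢w ∘ injective)
    }
    where open EdgeColoring c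

EdgeColoring-cong : ∀ {G s s' m} → (∀ u v → Adj G u v → σ s u v ≡ σ s' u v) →
  EdgeColoring G s m → EdgeColoring G s' m
EdgeColoring-cong s≗s' c = record
  { f      = f
  ; inM    = inM
  ; signed = λ u v u~v → subst (λ τ → f u v ≡ ℤ.- (sgn τ ℤ.* f v u)) (s≗s' u v u~v) (signed u v u~v)
  ; proper = proper
  }
  where open EdgeColoring c

Class1±-transfer : ∀ {G H} (φ : Embedding G H) (ψ : Embedding H G) →
  (∀ u → Embedding.⟦ ψ ⟧ (Embedding.⟦ φ ⟧ u) ≡ u) → Δ G ≡ Δ H → Class1± H → Class1± G
Class1±-transfer {G} φ ψ ψ∘φ≗id ΔG≡ΔH H-class s with H-class (pullback ψ s)
... | 1≤Δ , colouring , minimal = subst (ChromaticIndexIs G s) (sym ΔG≡ΔH)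
  ( 1≤Δ
  , EdgeColoring-cong (λ u v _ → cong₂ (σ s) (ψ∘φ≗id u) (ψ∘φ≗id v)) (restrict φ colouring)
  , λ k 1≤k k<Δ c → minimal k 1≤k k<Δ (restrict ψ c)
  )

-- Complete bipartite graphs

toℕ<ᵇ : ∀ {r} (i : Fin r) → (toℕ i <ᵇ r) ≡ true
toℕ<ᵇ Fin.zero    = refl
toℕ<ᵇ (Fin.suc i) = toℕ<ᵇ i

m+n<ᵇm : ∀ m n → (m + n <ᵇ m) ≡ false
m+n<ᵇm zero    n = refl
m+n<ᵇm (suc m) n = m+n<ᵇm m n

isLeft : ∀ r t → Fin (r + t) → Bool
isLeft r t u = toℕ u <ᵇ r

data Part (r t : ℕ) : Fin (r + t) → Set where
  left  : (i : Fin r) → Part r t (i ↑ˡ t)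
  right : (j : Fin t) → Part r t (r ↑ʳ j)

part : ∀ r t u → Part r t u
part r t u with splitAt r u in eq
... | inj₁ i = subst (Part r t) (Fin.splitAt⁻¹-↑ˡ eq) (left i)
... | inj₂ j = subst (Part r t) (Fin.splitAt⁻¹-↑ʳ eq) (right j)

isLeft-↑ˡ : ∀ {r} t (i : Fin r) → isLeft r t (i ↑ˡ t) ≡ true
isLeft-↑ˡ {r} t i = trans (cong (_<ᵇ r) (Fin.toℕ-↑ˡ i t)) (toℕ<ᵇ i)

isLeft-↑ʳ : ∀ r {t} (j : Fin t) → isLeft r t (r ↑ʳ j) ≡ false
isLeft-↑ʳ r j = trans (cong (_<ᵇ r) (Fin.toℕ-↑ʳ r j)) (m+n<ᵇm r (toℕ j))

K-adj : ∀ {r t} (i : Fin r) (j : Fin t) → Adj (K r t) (i ↑ˡ t) (r ↑ʳ j)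
K-adj {r} {t} i j = cong₂ _xor_ (isLeft-↑ˡ t i) (isLeft-↑ʳ r j)

K-nonadj-left : ∀ {r} t (i i' : Fin r) → ¬ Adj (K r t) (i ↑ˡ t) (i' ↑ˡ t)
K-nonadj-left t i i' i~i' with () ← trans (sym (cong₂ _xor_ (isLeft-↑ˡ t i) (isLeft-↑ˡ t i'))) i~i'

K-nonadj-right : ∀ r {t} (j j' : Fin t) → ¬ Adj (K r t) (r ↑ʳ j) (r ↑ʳ j')
K-nonadj-right r j j' j~j' with () ← trans (sym (cong₂ _xor_ (isLeft-↑ʳ r j) (isLeft-↑ʳ r j'))) j~j'

swap : ∀ r t → Fin (r + t) → Fin (t + r)
swap r t u = [ t ↑ʳ_ , _↑ˡ r ]′ (splitAt r u)

swap-↑ˡ : ∀ {r} t (i : Fin r) → swap r t (i ↑ˡ t) ≡ t ↑ʳ i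
swap-↑ˡ t i = cong [ t ↑ʳ_ , _↑ˡ _ ]′ (Fin.splitAt-↑ˡ _ i t)

swap-↑ʳ : ∀ r {t} (j : Fin t) → swap r t (r ↑ʳ j) ≡ j ↑ˡ r
swap-↑ʳ r j = cong [ _ ↑ʳ_ , _↑ˡ r ]′ (Fin.splitAt-↑ʳ r _ j)

swap-involutive : ∀ r t u → swap t r (swap r t u) ≡ u
swap-involutive r t u with part r t u
... | left i  = trans (cong (swap t r) (swap-↑ˡ t i)) (swap-↑ʳ t i)
... | right j = trans (cong (swap t r) (swap-↑ʳ r j)) (swap-↑ˡ r j)

isLeft-swap : ∀ r t u → isLeft t r (swap r t u) ≡ not (isLeft r t u)
isLeft-swap r t u with part r t u
... | left i  = trans (cong (isLeft t r) (swap-↑ˡ t i))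
                      (trans (isLeft-↑ʳ t i) (cong not (sym (isLeft-↑ˡ t i))))
... | right j = trans (cong (isLeft t r) (swap-↑ʳ r j))
                      (trans (isLeft-↑ˡ r j) (cong not (sym (isLeft-↑ʳ r j))))

swap-embedding : ∀ r t → Embedding (K r t) (K t r)
swap-embedding r t = record
  { ⟦_⟧           = swap r t
  ; injective     = λ {u} {v} eq →
      trans (sym (swap-involutive r t u)) (trans (cong (swap t r) eq) (swap-involutive r t v))
  ; preserves-adj = λ {u} {v} u~v →
      trans (cong₂ _xor_ (isLeft-swap r t u) (isLeft-swap r t v))
            (trans (xor-annihilates-not (isLeft r t u) (isLeft r t v)) u~v)
  }

sum-tabulate-+ : ∀ r t (g : Fin (r + t) → ℕ) →
  sum (tabulate g) ≡ sum (tabulate (g ∘ (_↑ˡ t))) + sum (tabulate (g ∘ (r ↑ʳ_)))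
sum-tabulate-+ zero    t g = refl
sum-tabulate-+ (suc r) t g =
  trans (cong (λ n → g Fin.zero + n) (sum-tabulate-+ r t (g ∘ Fin.suc))) (sym (ℕ.+-assoc (g Fin.zero) _ _))

sum-tabulate-const : ∀ {n} {g : Fin n → ℕ} {c} → (∀ i → g i ≡ c) → sum (tabulate g) ≡ n ℕ.* c
sum-tabulate-const {zero}  _   = refl
sum-tabulate-const {suc n} g≗c = cong₂ _+_ (g≗c Fin.zero) (sum-tabulate-const (g≗c ∘ Fin.suc))

module _ {r t : ℕ} where

  private
    indicator : Fin (r + t) → Fin (r + t) → ℕ
    indicator u v = if adj (K r t) u v then 1 else 0

    degree-split : ∀ u → degree (K r t) u ≡
      sum (tabulate (indicator u ∘ (_↑ˡ t))) + sum (tabulate (indicator u ∘ (r ↑ʳ_)))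
    degree-split u = trans (cong sum (map-tabulate id (indicator u))) (sum-tabulate-+ r t (indicator u))

  degree-↑ˡ : ∀ i → degree (K r t) (i ↑ˡ t) ≡ t
  degree-↑ˡ i = begin
    degree (K r t) (i ↑ˡ t)  ≡⟨ degree-split (i ↑ˡ t) ⟩
    sum (tabulate (indicator (i ↑ˡ t) ∘ (_↑ˡ t))) + sum (tabulate (indicator (i ↑ˡ t) ∘ (r ↑ʳ_)))
                             ≡⟨ cong₂ _+_ (sum-tabulate-const λ i' → cong (if_then 1 else 0) (nonadj i'))
                                          (sum-tabulate-const {t} λ j → cong (if_then 1 else 0) (K-adj i j)) ⟩
    r ℕ.* 0 + t ℕ.* 1        ≡⟨ cong₂ _+_ (ℕ.*-zeroʳ r) (ℕ.*-identityʳ t) ⟩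
    t                        ∎
    where
    nonadj : ∀ i' → adj (K r t) (i ↑ˡ t) (i' ↑ˡ t) ≡ false
    nonadj i' = cong₂ _xor_ (isLeft-↑ˡ t i) (isLeft-↑ˡ t i')

  degree-↑ʳ : ∀ j → degree (K r t) (r ↑ʳ j) ≡ r
  degree-↑ʳ j = begin
    degree (K r t) (r ↑ʳ j)  ≡⟨ degree-split (r ↑ʳ j) ⟩
    sum (tabulate (indicator (r ↑ʳ j) ∘ (_↑ˡ t))) + sum (tabulate (indicator (r ↑ʳ j) ∘ (r ↑ʳ_)))
                             ≡⟨ cong₂ _+_ (sum-tabulate-const λ i → cong (if_then 1 else 0) (adj⁻ i))
                                          (sum-tabulate-const λ j' → cong (if_then 1 else 0) (nonadj j')) ⟩
    r ℕ.* 1 + t ℕ.* 0        ≡⟨ cong₂ _+_ (ℕ.*-identityʳ r) (ℕ.*-zeroʳ t) ⟩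
    r + 0                    ≡⟨ ℕ.+-identityʳ r ⟩
    r                        ∎
    where
    adj⁻ : ∀ i → adj (K r t) (r ↑ʳ j) (i ↑ˡ t) ≡ true
    adj⁻ i = cong₂ _xor_ (isLeft-↑ʳ r j) (isLeft-↑ˡ t i)
    nonadj : ∀ j' → adj (K r t) (r ↑ʳ j) (r ↑ʳ j') ≡ false
    nonadj j' = cong₂ _xor_ (isLeft-↑ʳ r j) (isLeft-↑ʳ r j')

Δ-K : ∀ {r t} → 0 < r → 0 < t → Δ (K r t) ≡ r ⊔ t
Δ-K {suc r'} {suc t'} _ _ = ℕ.≤-antisym
  (Δ-least (K r t) degree≤r⊔t)
  (ℕ.⊔-lub (subst (_≤ Δ (K r t)) (degree-↑ʳ {r} {t} Fin.zero) (degree≤Δ (K r t) (r ↑ʳ Fin.zero)))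
           (subst (_≤ Δ (K r t)) (degree-↑ˡ {r} {t} Fin.zero) (degree≤Δ (K r t) (Fin.zero ↑ˡ t))))
  where
  r t : ℕ
  r = suc r'
  t = suc t'
  degree≤r⊔t : ∀ u → degree (K r t) u ≤ r ⊔ t
  degree≤r⊔t u with part r t u
  ... | left i  = subst (_≤ r ⊔ t) (sym (degree-↑ˡ i)) (ℕ.m≤n⊔m r t)
  ... | right j = subst (_≤ r ⊔ t) (sym (degree-↑ʳ j)) (ℕ.m≤m⊔n r t)

-- The colouring of K r t for r < t

module CyclicLatinSquare (T : ℕ) where

  Wraps : ℕ → ℕ → Set
  Wraps a y = a ≡ y ⊎ a ≡ T + y

  -- Symbol e stands in row x, column y of the cyclic Latin square of order T: y ≡ x + e (mod T).
  Cell : ℕ → ℕ → ℕ → Set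
  Cell x y e = Wraps (e + x) y

  private
    no-wrap : ∀ {a b} → a < T → a ≢ T + b
    no-wrap a<T refl = ℕ.<⇒≱ a<T (ℕ.m≤m+n T _)

  wraps-functional : ∀ {a y y'} → y < T → y' < T → Wraps a y → Wraps a y' → y ≡ y'
  wraps-functional _    _     (inj₁ p) (inj₁ q) = trans (sym p) q
  wraps-functional _    _     (inj₂ p) (inj₂ q) = ℕ.+-cancelˡ-≡ T _ _ (trans (sym p) q)
  wraps-functional y<T  _     (inj₁ p) (inj₂ q) = ⊥-elim (no-wrap y<T (trans (sym p) q))
  wraps-functional _    y'<T  (inj₂ p) (inj₁ q) = ⊥-elim (no-wrap y'<T (trans (sym q) p))

  wraps-cancelʳ : ∀ {a a' x y} → a < T → a' < T → Wraps (a + x) y → Wraps (a' + x) y → a ≡ a'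
  wraps-cancelʳ {a} {a'} {x} _ _ (inj₁ p) (inj₁ q) = ℕ.+-cancelʳ-≡ x a a' (trans p (sym q))
  wraps-cancelʳ {a} {a'} {x} _ _ (inj₂ p) (inj₂ q) = ℕ.+-cancelʳ-≡ x a a' (trans p (sym q))
  wraps-cancelʳ {a} {a'} {x} _ a'<T (inj₁ p) (inj₂ q) = ⊥-elim (no-wrap a'<T
    (ℕ.+-cancelʳ-≡ x a' (T + a) (trans q (trans (cong (T ℕ.+_) (sym p)) (sym (ℕ.+-assoc T a x))))))
  wraps-cancelʳ {a} {a'} {x} a<T _ (inj₂ p) (inj₁ q) = ⊥-elim (no-wrap a<T
    (ℕ.+-cancelʳ-≡ x a (T + a') (trans p (trans (cong (T ℕ.+_) (sym q)) (sym (ℕ.+-assoc T a' x))))))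

  cell-unique-row : ∀ {x x' y e} → x < T → x' < T → Cell x y e → Cell x' y e → x ≡ x'
  cell-unique-row {x} {x'} {y} {e} x<T x'<T c c' =
    wraps-cancelʳ x<T x'<T (subst (λ a → Wraps a y) (ℕ.+-comm e x) c)
                           (subst (λ a → Wraps a y) (ℕ.+-comm e x') c')

  cell-suc : ∀ {x y e} → Cell x y (suc e) → Cell (suc x) y e
  cell-suc {x} {y} {e} = subst (λ a → Wraps a y) (sym (+-suc e x))

  diff : ℕ → ℕ → ℕ
  diff x y with x ≤? y
  ... | yes _ = y ∸ x
  ... | no  _ = T + y ∸ x

  diff-cell : ∀ {x y} → x < T → y < T → diff x y < T × Cell x y (diff x y)
  diff-cell {x} {y} x<T y<T with x ≤? y
  ... | yes x≤y = ℕ.≤-<-trans (ℕ.m∸n≤m y x) y<T , inj₁ (ℕ.m∸n+n≡m x≤y)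
  ... | no  x≰y = ℕ.+-cancelʳ-< x (T + y ∸ x) T (subst (_< T + x) (sym wrap) (ℕ.+-monoʳ-< T (ℕ.≰⇒> x≰y)))
                , inj₂ wrap
    where
    wrap : T + y ∸ x + x ≡ T + y
    wrap = ℕ.m∸n+n≡m (ℕ.≤-trans (ℕ.<⇒≤ x<T) (ℕ.m≤m+n T y))

  diff-cancelˡ : ∀ {x y y'} → x < T → y < T → y' < T → diff x y ≡ diff x y' → y ≡ y'
  diff-cancelˡ {x} {y} {y'} x<T y<T y'<T eq =
    wraps-functional y<T y'<T (proj₂ (diff-cell x<T y<T))
                              (subst (Cell x y') (sym eq) (proj₂ (diff-cell x<T y'<T)))

  diff-cancelʳ : ∀ {x x' y} → x < T → x' < T → y < T → diff x y ≡ diff x' y → x ≡ x'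
  diff-cancelʳ {x} {x'} {y} x<T x'<T y<T eq =
    cell-unique-row x<T x'<T (proj₂ (diff-cell x<T y<T))
                             (subst (Cell x' y) (sym eq) (proj₂ (diff-cell x'<T y<T)))

  shift : ℕ → ℕ → ℕ
  shift x e with x + e ℕ.<? T
  ... | yes _ = x + e
  ... | no  _ = x + e ∸ T

  shift-cell : ∀ {x e} → x < T → e < T → shift x e < T × Cell x (shift x e) e
  shift-cell {x} {e} x<T e<T with x + e ℕ.<? T
  ... | yes x+e<T = x+e<T , inj₁ (ℕ.+-comm e x)
  ... | no  x+e≮T = ℕ.+-cancelˡ-< T (x + e ∸ T) T (subst (_< T + T) (sym unwrap) (ℕ.+-mono-< x<T e<T))
                  , inj₂ (trans (ℕ.+-comm e x) (sym unwrap))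
    where
    unwrap : T + (x + e ∸ T) ≡ x + e
    unwrap = ℕ.m+[n∸m]≡n (ℕ.≮⇒≥ x+e≮T)

module Switching (T R : ℕ) (R<T : R < T) (σ : ℕ → ℕ → Sign) where
  open CyclicLatinSquare T

  oddColumn : ℕ → ℕ → ℕ
  oddColumn i x = shift x (suc (2 ℕ.* i))

  -- The recursion makes the incidences at
  -- column oddColumn i x of the edges with symbols 2i+1 (row x) and 2i (row x+1) get distinct
  -- colours there (switch-suc); it needs x+1 < T, i.e. fewer rows than columns.
  switch : ℕ → ℕ → Sign
  switch i zero    = Sign.+
  switch i (suc x) = (switch i x * σ x (oddColumn i x)) * σ (suc x) (oddColumn i x)

  switch-suc : ∀ i x → let b = oddColumn i x in
    σ (suc x) b * switch i (suc x) ≡ σ x b * switch i x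
  switch-suc i x = begin
    d * ((a * c) * d)  ≡⟨ Sign.*-comm d _ ⟩
    ((a * c) * d) * d  ≡⟨ Sign.*-assoc (a * c) d d ⟩
    (a * c) * (d * d)  ≡⟨ cong ((a * c) *_) (Sign.s*s≡+ d) ⟩
    (a * c) * Sign.+        ≡⟨ Sign.*-identityʳ (a * c) ⟩
    a * c                        ≡⟨ Sign.*-comm a c ⟩
    c * a                        ∎
    where
    a c d : Sign
    a = switch i x
    c = σ x (oddColumn i x)
    d = σ (suc x) (oddColumn i x)

  colourAt : ℕ → ℕ → ℤ
  colourAt x y = colour T (switch ⌊ diff x y /2⌋ x) (diff x y)

  colourAt-inM : ∀ {x y} → x < T → y < T → InM T (colourAt x y)
  colourAt-inM x<T y<T = colour-inM _ (proj₁ (diff-cell x<T y<T))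

  colourAt-row-injective : ∀ {x y y'} → x < T → y < T → y' < T → colourAt x y ≡ colourAt x y' → y ≡ y'
  colourAt-row-injective {x} x<T y<T y'<T eq = diff-cancelˡ x<T y<T y'<T
    (colour-injective (λ i → switch i x) (proj₁ (diff-cell x<T y<T)) (proj₁ (diff-cell x<T y'<T)) eq)

  private
    x<T : ∀ {x} → x < R → x < T
    x<T x<R = ℕ.<-trans x<R R<T

    diff<T : ∀ {x y} → x < R → y < T → diff x y < T
    diff<T x<R y<T = proj₁ (diff-cell (x<T x<R) y<T)

    diff-cell′ : ∀ {x y} → x < R → y < T → Cell x y (diff x y)
    diff-cell′ x<R y<T = proj₂ (diff-cell (x<T x<R) y<T)

  odd-even-clash : ∀ {x x' y} → x < R → x' < R → y < T → let e = diff x y; e' = diff x' y in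
    ⌊ e /2⌋ ≡ ⌊ e' /2⌋ → parity e ≡ 1ℙ → parity e' ≡ 0ℙ →
    (σ x y * switch ⌊ e /2⌋ x) * Sign.- ≢ (σ x' y * switch ⌊ e' /2⌋ x') * Sign.+
  odd-even-clash {x} {x'} {y} x<R x'<R y<T half≡ odd even signs =
    Sign.s≢opposite[s] Sign.-
      (Sign.*-cancelˡ-≡ (σ x y * switch i x) _ _ (trans signs (cong (_* Sign.+) rows-agree)))
    where
    e i b : ℕ
    e = diff x y
    i = ⌊ e /2⌋
    b = oddColumn i x
    next-row : suc x ≡ x'
    next-row = cell-unique-row (ℕ.<-≤-trans (s≤s x<R) R<T) (x<T x'<R)
      (cell-suc (subst (Cell x y) (⌊/2⌋-odd≡suc-even half≡ odd even) (diff-cell′ x<R y<T))) (diff-cell′ x'<R y<T)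
    odd-column : y ≡ b
    odd-column =
      wraps-functional y<T (proj₁ odd-cell) (subst (Cell x y) e≡1+2i (diff-cell′ x<R y<T)) (proj₂ odd-cell)
      where
      e≡1+2i : e ≡ suc (2 ℕ.* i)
      e≡1+2i = odd⇒≡1+2*⌊/2⌋ odd
      odd-cell : b < T × Cell x b (suc (2 ℕ.* i))
      odd-cell = shift-cell (x<T x<R) (subst (_< T) e≡1+2i (diff<T x<R y<T))
    rows-agree : σ x' y * switch ⌊ diff x' y /2⌋ x' ≡ σ x y * switch i x
    rows-agree = begin
      σ x' y * switch ⌊ diff x' y /2⌋ x' ≡⟨ cong₂ (λ z h → σ z y * switch h z) (sym next-row) (sym half≡) ⟩
      σ (suc x) y * switch i (suc x)     ≡⟨ cong (λ z → σ (suc x) z * switch i (suc x)) odd-column ⟩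
      σ (suc x) b * switch i (suc x)     ≡⟨ switch-suc i x ⟩
      σ x b * switch i x                 ≡⟨ cong (λ z → σ x z * switch i x) odd-column ⟨
      σ x y * switch i x                 ∎

  colourAt-column-injective : ∀ {x x' y} → x < R → x' < R → y < T →
    sgn (σ x y) ℤ.* colourAt x y ≡ sgn (σ x' y) ℤ.* colourAt x' y → x ≡ x'
  colourAt-column-injective {x} {x'} {y} x<R x'<R y<T eq
    with colour-clash _ _ (diff<T x<R y<T) (diff<T x'<R y<T)
           (trans (sym (sgn-*-colour T (σ x y) (switch ⌊ diff x y /2⌋ x) (diff x y)))
           (trans eq (sgn-*-colour T (σ x' y) (switch ⌊ diff x' y /2⌋ x') (diff x' y))))
  ... | inj₁ e≡e' = diff-cancelʳ (x<T x<R) (x<T x'<R) y<T e≡e'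
  ... | inj₂ (half≡ , signs) with parity (diff x y) in pe | parity (diff x' y) in pe'
  ...   | 0ℙ | 0ℙ = diff-cancelʳ (x<T x<R) (x<T x'<R) y<T
                      (⌊/2⌋-parity-injective half≡ (trans pe (sym pe')))
  ...   | 1ℙ | 1ℙ = diff-cancelʳ (x<T x<R) (x<T x'<R) y<T
                      (⌊/2⌋-parity-injective half≡ (trans pe (sym pe')))
  ...   | 1ℙ | 0ℙ = ⊥-elim (odd-even-clash x<R x'<R y<T half≡ pe pe' signs)
  ...   | 0ℙ | 1ℙ = ⊥-elim (odd-even-clash x'<R x<R y<T (sym half≡) pe' pe (sym signs))

toℕ-mod : ∀ {n} .{{_ : ℕ.NonZero n}} (i : Fin n) → toℕ i mod n ≡ i
toℕ-mod i = Fin.toℕ-injective (trans (Fin.toℕ-fromℕ< _) (m<n⇒m%n≡m (Fin.toℕ<n i)))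

module BipartiteColouring {r t} (0<r : 0 < r) (r<t : r < t) (s : Signature (K r t)) where

  private instance
    r≢0 : ℕ.NonZero r
    r≢0 = ℕ.>-nonZero 0<r
    t≢0 : ℕ.NonZero t
    t≢0 = ℕ.>-nonZero (ℕ.<-trans 0<r r<t)

  -- σ on the edge from left vertex x to right vertex y; out-of-range arguments are reduced
  -- mod r and mod t, values the colouring never looks at.
  σ′ : ℕ → ℕ → Sign
  σ′ x y = σ s ((x mod r) ↑ˡ t) (r ↑ʳ (y mod t))

  open Switching t r r<t σ′

  σ-↑ˡ↑ʳ : ∀ i j → σ s (i ↑ˡ t) (r ↑ʳ j) ≡ σ′ (toℕ i) (toℕ j)
  σ-↑ˡ↑ʳ i j = sym (cong₂ (λ a b → σ s (a ↑ˡ t) (r ↑ʳ b)) (toℕ-mod i) (toℕ-mod j))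

  σ-↑ʳ↑ˡ : ∀ i j → σ s (r ↑ʳ j) (i ↑ˡ t) ≡ σ′ (toℕ i) (toℕ j)
  σ-↑ʳ↑ˡ i j = trans (sym (σ-sym s _ _ (K-adj i j))) (σ-↑ˡ↑ʳ i j)

  toℕ<t : (i : Fin r) → toℕ i < t
  toℕ<t i = ℕ.<-trans (Fin.toℕ<n i) r<t

  -- Incidences of non-edges (both ends in the same part) get the irrelevant value 0.
  f : Fin (r + t) → Fin (r + t) → ℤ
  f u v with part r t u | part r t v
  ... | left i  | right j = colourAt (toℕ i) (toℕ j)
  ... | right j | left i  = ℤ.- (sgn (σ s (r ↑ʳ j) (i ↑ˡ t)) ℤ.* colourAt (toℕ i) (toℕ j))
  ... | _       | _       = + 0

  inM : ∀ u v → Adj (K r t) u v → InM t (f u v)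
  inM u v u~v with part r t u | part r t v
  ... | left i  | right j  = colourAt-inM (toℕ<t i) (Fin.toℕ<n j)
  ... | right j | left i   = InM-neg-sgn* (σ s (r ↑ʳ j) (i ↑ˡ t)) (colourAt (toℕ i) (toℕ j))
                               (colourAt-inM (toℕ<t i) (Fin.toℕ<n j))
  ... | left i  | left i'  = ⊥-elim (K-nonadj-left t i i' u~v)
  ... | right j | right j' = ⊥-elim (K-nonadj-right r j j' u~v)

  signed : ∀ u v → Adj (K r t) u v → f u v ≡ ℤ.- (sgn (σ s u v) ℤ.* f v u)
  signed u v u~v with part r t u | part r t v
  ... | left i  | right j  =
    trans (sym (-sgn*-involutive τ c)) (cong (λ τ' → ℤ.- (sgn τ ℤ.* ℤ.- (sgn τ' ℤ.* c))) (σ-sym s _ _ u~v))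
    where
    τ : Sign
    τ = σ s (i ↑ˡ t) (r ↑ʳ j)
    c : ℤ
    c = colourAt (toℕ i) (toℕ j)
  ... | right j | left i   = refl
  ... | left i  | left i'  = ⊥-elim (K-nonadj-left t i i' u~v)
  ... | right j | right j' = ⊥-elim (K-nonadj-right r j j' u~v)

  proper : ∀ u v w → Adj (K r t) u v → Adj (K r t) u w → v ≢ w → f u v ≢ f u w
  proper u v w u~v u~w v≢w eq with part r t u | part r t v | part r t w
  ... | left i  | right j | right j' =
    v≢w (cong (r ↑ʳ_) (Fin.toℕ-injective (colourAt-row-injective (toℕ<t i) (Fin.toℕ<n j) (Fin.toℕ<n j') eq)))
  ... | right j | left i  | left i'  =
    v≢w (cong (_↑ˡ t) (Fin.toℕ-injective (colourAt-column-injective (Fin.toℕ<n i) (Fin.toℕ<n i') (Fin.toℕ<n j)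
      (subst₂ (λ τ τ' → sgn τ ℤ.* c ≡ sgn τ' ℤ.* c') (σ-↑ʳ↑ˡ i j) (σ-↑ʳ↑ˡ i' j) (ℤ.neg-injective eq)))))
    where
    c c' : ℤ
    c = colourAt (toℕ i) (toℕ j)
    c' = colourAt (toℕ i') (toℕ j)
  ... | left i  | left i' | _        = ⊥-elim (K-nonadj-left t i i' u~v)
  ... | left i  | right _ | left i'  = ⊥-elim (K-nonadj-left t i i' u~w)
  ... | right j | right j' | _       = ⊥-elim (K-nonadj-right r j j' u~v)
  ... | right j | left _  | right j' = ⊥-elim (K-nonadj-right r j j' u~w)

  colouring : EdgeColoring (K r t) s t
  colouring = record { f = f ; inM = inM ; signed = signed ; proper = proper }

Class1±-K< : ∀ {r t} → 0 < r → r < t → Class1± (K r t)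
Class1±-K< {r} {t} 0<r r<t s = subst (ChromaticIndexIs (K r t) s) (sym Δ≡t)
  (0<t , BipartiteColouring.colouring 0<r r<t s , λ k _ k<t c → ℕ.<⇒≱ k<t (t≤colours c))
  where
  0<t : 0 < t
  0<t = ℕ.<-trans 0<r r<t
  Δ≡t : Δ (K r t) ≡ t
  Δ≡t = trans (Δ-K 0<r 0<t) (ℕ.m≤n⇒m⊔n≡n (ℕ.<⇒≤ r<t))
  t≤colours : ∀ {k} → EdgeColoring (K r t) s k → t ≤ k
  t≤colours c = neighbours≤colours c (r ↑ʳ_) (Fin.↑ʳ-injective r _ _) (K-adj (fromℕ< 0<r))

theorem7 : (r t : ℕ) → 1 ≤ r → 1 ≤ t → r ≢ t → Class1± (K r t)
theorem7 r t 1≤r 1≤t r≢t with ℕ.<-cmp r t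
... | tri< r<t _ _ = Class1±-K< 1≤r r<t
... | tri≈ _ r≡t _ = ⊥-elim (r≢t r≡t)
... | tri> _ _ t<r = Class1±-transfer (swap-embedding r t) (swap-embedding t r) (swap-involutive r t)
  (trans (Δ-K 1≤r 1≤t) (trans (ℕ.⊔-comm r t) (sym (Δ-K 1≤t 1≤r)))) (Class1±-K< 1≤t t<r)
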